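{- Let $A,B\in\mathbb{R}^2$ be orthogonal vectors of equal length, $\Lambda=\mathbb{Z}A+\mathbb{Z}B$, $\psi$ the rotation by $90^\circ$ with $\psi(A)=B$, $\psi(B)=-A$, and $T$ the linear map with $T(A)=-A$, $T(B)=B$. For every positive integer $n$, the number of subgroups $K\le\Lambda$ of index $n$ with $\psi(K)=K$ and $T(K)=K$ equals $$h(n)=\sum_{d\mid n,\ n\mid d^2}\rho_7\!\left(\frac{d^2}{n}\right),\qquad \rho_7(m)=\#\{x\in\mathbb{Z}_m:\ x^2+1\equiv 0 \text{ and } 2x\equiv 0 \pmod m\}.$$
   Context: This concerns $n$-sheeted toroidal covers $X=E/K$ of the minimal map of the tiling of type $[3^2,4^1,3^1,4^1]$, whose glide reflection has linear part $T$; the $90^\circ$ rotation $\psi$ (resp. the glide) lies in $\mathrm{Aut}(X)$ iff $\psi(K)=K$ (resp. $T(K)=K$). -}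

module Defs where

open import Level using (0ℓ)
open import Data.Nat as ℕ using (ℕ; suc)
open import Data.Nat.Divisibility using (_∣_; _∣?_; divides)
open import Data.Integer as ℤ using (ℤ)
open import Data.Fin using (Fin)
open import Data.List using (List; upTo; map; filter; length)
open import Data.Nat.ListAction using (sum)
open import Data.Product using (Σ; ∃; _×_; _,_)
open import Relation.Nullary using (yes; no)
open import Relation.Nullary.Decidable using (_×-dec_)
open import Relation.Unary using (Pred)
open import Relation.Binary.PropositionalEquality using (_≡_)
open import Function.Bundles using (_⇔_)

-- Λ = ℤA + ℤB, identified with ℤ × ℤ via the basis (A , B):
-- (a , b) stands for a·A + b·B.
Λ : Set
Λ = ℤ × ℤ

_+ᵥ_ : Λ → Λ → Λ
(a , b) +ᵥ (c , d) = (a ℤ.+ c , b ℤ.+ d)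

-ᵥ_ : Λ → Λ
-ᵥ (a , b) = (ℤ.- a , ℤ.- b)

_-ᵥ_ : Λ → Λ → Λ
v -ᵥ w = v +ᵥ (-ᵥ w)

0ᵥ : Λ
0ᵥ = (ℤ.0ℤ , ℤ.0ℤ)

-- ψ(A) = B, ψ(B) = -A :  ψ(aA + bB) = -b A + a B
ψ : Λ → Λ
ψ (a , b) = (ℤ.- b , a)

-- T(A) = -A, T(B) = B :  T(aA + bB) = -a A + b B
T : Λ → Λ
T (a , b) = (ℤ.- a , b)

Subset : Set₁
Subset = Pred Λ 0ℓ

record IsSubgroup (K : Subset) : Set where
  field
    has-zero : K 0ᵥ
    closed-+ : ∀ {v w} → K v → K w → K (v +ᵥ w)
    closed-- : ∀ {v} → K v → K (-ᵥ v)

-- [Λ : K] = n : there are n cosets, given by representatives r 0 … r (n-1)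
-- (every element is congruent mod K to some r i, and the r i are pairwise
-- incongruent mod K).
HasIndex : Subset → ℕ → Set
HasIndex K n =
  Σ (Fin n → Λ) λ r →
    (∀ v → ∃ λ i → K (v -ᵥ r i)) ×
    (∀ i j → K (r i -ᵥ r j) → i ≡ j)

Image : (Λ → Λ) → Subset → Subset
Image f K w = ∃ λ v → K v × f v ≡ w

_≐_ : Subset → Subset → Set
K ≐ L = ∀ v → K v ⇔ L v

Preserves : (Λ → Λ) → Subset → Set
Preserves f K = Image f K ≐ K

HasCount : (Subset → Set) → ℕ → Set₁
HasCount P N =
  Σ (Fin N → Subset) λ f →
    (∀ i → P (f i)) ×
    (∀ i j → f i ≐ f j → i ≡ j) ×
    (∀ K → P K → ∃ λ i → f i ≐ K)

ρ₇ : ℕ → ℕ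
ρ₇ m = length (filter (λ x → (m ∣? x ℕ.* x ℕ.+ 1) ×-dec (m ∣? 2 ℕ.* x)) (upTo m))

hTerm : ℕ → ℕ → ℕ
hTerm n d with d ∣? n | n ∣? (d ℕ.* d)
... | yes _ | yes (divides q _) = ρ₇ q
... | _     | _                 = 0

-- h(n) = Σ_{d ∣ n, n ∣ d²} ρ₇(d²/n); for n ≥ 1 the positive divisors lie in 1..n
h : ℕ → ℕ
h n = sum (map (λ k → hTerm n (suc k)) (upTo n))

-- A subgroup K of finite index that is stable under ψ and T contains a least (m , 0)
-- with m > 0, and then mΛ ⊆ K because ψ(m , 0) = (0 , m).  For (a , b) ∈ K the vector
-- (a , b) - T(a , b) = (2a , 0) lies in K, and so does (2b , 0) after a rotation; by
-- minimality of m the only residues of K modulo mΛ are 0 and, when m = 2k, (k , k).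
-- So K is mΛ, of index m², or is spanned by (k , k) and (0 , 2k), of index 2k², and
-- the two kinds never share an index because √2 is irrational.  On the other side
-- ρ₇(q) = 0 for q ≥ 3, so the summand of h(n) at d is nonzero exactly when d² = n or
-- d² = 2n, and h(n) is 1 or 0 according as such a d exists or not.

module Submission where

open import Defs
open import Data.Fin as Fin using (Fin; toℕ; fromℕ<)
import Data.Fin.Properties as Fin
open import Data.Nat as ℕ using (ℕ; zero; suc; _≥_)
import Data.Nat.Properties as ℕ
open import Data.Product using (∃; ∃₂; _×_; _,_; proj₁; proj₂; uncurry)
open import Data.Sum using (_⊎_; inj₁; inj₂)
open import Function using (_∘_; case_of_)
open import Function.Bundles using (mk⇔; Equivalence)
import Function.Properties.Equivalence as ⇔
open import Relation.Nullary using (Dec; yes; no; ¬_; ¬?; contradiction)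
open import Relation.Nullary.Decidable using (_×-dec_; decidable-stable)
open import Relation.Binary.PropositionalEquality

open Equivalence using (to; from)

module Arithmetic where

  open import Data.List using (length; applyUpTo)
  open import Data.List.Properties using (map-upTo; filter-none)
  import Data.List.Relation.Unary.All as All
  open import Data.List.Relation.Unary.All.Properties using (all-upTo)
  open import Data.Nat using (pred; _+_; _*_; _<_; _≤_; z≤n; s≤s; NonZero)
  open import Data.Nat.Divisibility using (_∣_; _∣?_; divides; ∣-trans; ∣m+n∣m⇒∣n; ∣1⇒≡1; m∣m*n)
  open import Data.Nat.Induction using (<-rec)
  open import Data.Nat.ListAction using (sum)
  open import Data.Nat.Primality using (euclidsLemma; prime[2])
  open import Data.Nat.Properties
  open import Data.Nat.Tactic.RingSolver using (solve-∀)
  open import Data.Sum using ([_,_]′)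
  open import Function using (id)
  open import Relation.Binary.Definitions using (tri<; tri≈; tri>)

  square-injective : ∀ m n → m * m ≡ n * n → m ≡ n
  square-injective m n eq with <-cmp m n
  ... | tri< m<n _ _ = contradiction eq (<⇒≢ (*-mono-< m<n m<n))
  ... | tri≈ _ m≡n _ = m≡n
  ... | tri> _ _ n<m = contradiction (sym eq) (<⇒≢ (*-mono-< n<m n<m))

  half-of-even-square : ∀ m k → m * m ≡ 2 * k → ∃ λ c → m ≡ 2 * c × k ≡ 2 * (c * c)
  half-of-even-square m k m²≡2k
    with [ id , id ]′ (euclidsLemma m m prime[2] (divides k (trans m²≡2k (*-comm 2 k))))
  ... | divides c refl =
    c , *-comm c 2 , *-cancelˡ-≡ k (2 * (c * c)) 2 (trans (sym m²≡2k) (square-of-double c))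
    where
    square-of-double : ∀ c → c * 2 * (c * 2) ≡ 2 * (2 * (c * c))
    square-of-double = solve-∀

  √2-irrational : ∀ m n → m * m ≡ 2 * (n * n) → n ≡ 0
  √2-irrational = <-rec _ descent
    where
    descent : ∀ m → (∀ {m′} → m′ < m → ∀ n → m′ * m′ ≡ 2 * (n * n) → n ≡ 0) →
              ∀ n → m * m ≡ 2 * (n * n) → n ≡ 0
    -- m = 2c and n = 2e with c² = 2e², and c < m unless n = 0.
    descent m smaller n m²≡2n² with half-of-even-square m (n * n) m²≡2n²
    ... | zero  , _    , n²≡0   = [ id , id ]′ (m*n≡0⇒m≡0∨n≡0 n n²≡0)
    ... | suc c , refl , n²≡2c² with half-of-even-square n (suc c * suc c) n²≡2c²
    ...   | e , refl , c²≡2e² = cong (2 *_) (smaller (m<m+n (suc c) (s≤s z≤n)) e c²≡2e²)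

  q∣2x⇒x≡0⊎2x≡q : ∀ {x q} → x < q → q ∣ 2 * x → x ≡ 0 ⊎ 2 * x ≡ q
  q∣2x⇒x≡0⊎2x≡q {x}     _   (divides 0 2x≡0) = inj₁ (m*n≡0⇒m≡0 x 2 (trans (*-comm x 2) 2x≡0))
  q∣2x⇒x≡0⊎2x≡q {x} {q} _   (divides 1 2x≡q) = inj₂ (trans 2x≡q (+-identityʳ q))
  q∣2x⇒x≡0⊎2x≡q {x} {q} x<q (divides (suc (suc c)) 2x≡cq) = contradiction 2x≡cq (<⇒≢ (begin-strict
    2 * x           <⟨ *-monoʳ-< 2 x<q ⟩
    2 * q           ≤⟨ *-monoˡ-≤ q (s≤s (s≤s (z≤n {c}))) ⟩
    suc (suc c) * q ∎))
    where open ≤-Reasoning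

  3≤q⇒ρ₇≡0 : ∀ {q} → 3 ≤ q → ρ₇ q ≡ 0
  3≤q⇒ρ₇≡0 {q} 3≤q = cong length (filter-none _ (All.map no-root (all-upTo q)))
    where
    no-root : ∀ {x} → x < q → ¬ (q ∣ x * x + 1 × q ∣ 2 * x)
    no-root {x} x<q (q∣x²+1 , q∣2x) with q∣2x⇒x≡0⊎2x≡q x<q q∣2x
    ... | inj₁ refl = contradiction (subst (3 ≤_) (∣1⇒≡1 q∣x²+1) 3≤q) λ { (s≤s ()) }
    ... | inj₂ 2x≡q
      with ∣1⇒≡1 {x} (∣m+n∣m⇒∣n (∣-trans (divides 2 (sym 2x≡q)) q∣x²+1) (m∣m*n {x} x))
    ...   | refl = contradiction (subst (3 ≤_) (sym 2x≡q) 3≤q) λ { (s≤s (s≤s ())) }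

  ρ₇≢0⇒q≡1⊎q≡2 : ∀ {q} → ρ₇ q ≢ 0 → q ≡ 1 ⊎ q ≡ 2
  ρ₇≢0⇒q≡1⊎q≡2 {0}                 ρ₇≢0 = contradiction refl ρ₇≢0
  ρ₇≢0⇒q≡1⊎q≡2 {1}                 _    = inj₁ refl
  ρ₇≢0⇒q≡1⊎q≡2 {2}                 _    = inj₂ refl
  ρ₇≢0⇒q≡1⊎q≡2 {suc (suc (suc q))} ρ₇≢0 =
    contradiction (3≤q⇒ρ₇≡0 {3 + q} (s≤s (s≤s (s≤s z≤n)))) ρ₇≢0

  hTerm-value : ∀ {n d q} .{{_ : NonZero n}} → d ∣ n → d * d ≡ q * n → hTerm n d ≡ ρ₇ q
  hTerm-value {n} {d} {q} d∣n d²≡qn with d ∣? n | n ∣? (d * d)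
  ... | yes _  | yes (divides q′ d²≡q′n) = cong ρ₇ (*-cancelʳ-≡ q′ q n (trans (sym d²≡q′n) d²≡qn))
  ... | yes _  | no n∤d²                 = contradiction (divides q d²≡qn) n∤d²
  ... | no d∤n | _                       = contradiction d∣n d∤n

  hTerm-support : ∀ {n d} → hTerm n d ≢ 0 → ∃ λ q → d * d ≡ q * n × ρ₇ q ≢ 0
  hTerm-support {n} {d} term≢0 with d ∣? n | n ∣? (d * d)
  ... | yes _ | yes (divides q d²≡qn) = q , d²≡qn , term≢0
  ... | yes _ | no _                  = contradiction refl term≢0
  ... | no _  | _                     = contradiction refl term≢0

  -- Parameters are shifted by one, so that no shape is degenerate; root s is the only d
  -- with a nonzero summand in h (index s).
  data Shape : Set where
    square twiceSquare : ℕ → Shape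

  index : Shape → ℕ
  index (square m)      = suc m * suc m
  index (twiceSquare k) = suc k * (2 * suc k)

  root : Shape → ℕ
  root (square m)      = suc m
  root (twiceSquare k) = 2 * suc k

  k*2k≡2k² : ∀ k → k * (2 * k) ≡ 2 * (k * k)
  k*2k≡2k² = solve-∀

  index-injective : ∀ s t → index s ≡ index t → s ≡ t
  index-injective (square m) (square m′) eq =
    cong (square ∘ pred) (square-injective (suc m) (suc m′) eq)
  index-injective (twiceSquare k) (twiceSquare k′) eq =
    cong (twiceSquare ∘ pred) (square-injective (suc k) (suc k′)
      (*-cancelˡ-≡ _ _ 2 (trans (sym (k*2k≡2k² (suc k))) (trans eq (k*2k≡2k² (suc k′))))))
  index-injective (square m) (twiceSquare k) eq =
    contradiction (√2-irrational (suc m) (suc k) (trans eq (k*2k≡2k² (suc k)))) λ ()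
  index-injective (twiceSquare k) (square m) eq =
    contradiction (√2-irrational (suc m) (suc k) (trans (sym eq) (k*2k≡2k² (suc k)))) λ ()

  hTerm-root : ∀ s → hTerm (index s) (root s) ≡ 1
  hTerm-root (square m)      = hTerm-value {q = 1} (divides (suc m) refl) (sym (*-identityˡ (suc m * suc m)))
  hTerm-root (twiceSquare k) = hTerm-value {q = 2} (divides (suc k) refl) (root² (suc k))
    where
    root² : ∀ k → 2 * k * (2 * k) ≡ 2 * (k * (2 * k))
    root² = solve-∀

  hTerm≢0⇒root : ∀ {n d} → hTerm n (suc d) ≢ 0 → ∃ λ s → index s ≡ n × root s ≡ suc d
  hTerm≢0⇒root {n} {d} term≢0 with hTerm-support term≢0
  ... | q , d²≡qn , ρ₇≢0 with ρ₇≢0⇒q≡1⊎q≡2 {q} ρ₇≢0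
  ...   | inj₁ refl = square d , trans d²≡qn (*-identityˡ n) , refl
  ...   | inj₂ refl with half-of-even-square (suc d) n d²≡qn
  ...     | suc c , 2c≡d , n≡2c² = twiceSquare c , trans (k*2k≡2k² (suc c)) (sym n≡2c²) , sym 2c≡d

  sum-applyUpTo-zero : ∀ n (g : ℕ → ℕ) → (∀ k → g k ≡ 0) → sum (applyUpTo g n) ≡ 0
  sum-applyUpTo-zero zero    g g≡0 = refl
  sum-applyUpTo-zero (suc n) g g≡0 = cong₂ _+_ (g≡0 0) (sum-applyUpTo-zero n (g ∘ suc) (g≡0 ∘ suc))

  sum-applyUpTo-single : ∀ n (g : ℕ → ℕ) {k₀} → k₀ < n → (∀ k → k ≢ k₀ → g k ≡ 0) →
                         sum (applyUpTo g n) ≡ g k₀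
  sum-applyUpTo-single (suc n) g {zero} _ off =
    trans (cong (g 0 +_) (sum-applyUpTo-zero n (g ∘ suc) (λ k → off (suc k) λ ()))) (+-identityʳ (g 0))
  sum-applyUpTo-single (suc n) g {suc k₀} (s≤s k₀<n) off =
    cong₂ _+_ (off 0 λ ())
      (sum-applyUpTo-single n (g ∘ suc) k₀<n (λ k k≢k₀ → off (suc k) (k≢k₀ ∘ suc-injective)))

  sum-applyUpTo≢0 : ∀ n (g : ℕ → ℕ) → sum (applyUpTo g n) ≢ 0 → ∃ λ k → g k ≢ 0
  sum-applyUpTo≢0 zero    g sum≢0 = contradiction refl sum≢0
  sum-applyUpTo≢0 (suc n) g sum≢0 with g 0 ≟ 0
  ... | no  g0≢0 = 0 , g0≢0
  ... | yes g0≡0 with sum-applyUpTo≢0 n (g ∘ suc) (λ rest≡0 → sum≢0 (cong₂ _+_ g0≡0 rest≡0))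
  ...   | k , gk≢0 = suc k , gk≢0

  root≤index : ∀ s → root s ≤ index s
  root≤index (square m)      = m≤m*n (suc m) (suc m)
  root≤index (twiceSquare k) = m≤n*m (2 * suc k) (suc k)

  suc-pred-root : ∀ s → suc (pred (root s)) ≡ root s
  suc-pred-root (square _)      = refl
  suc-pred-root (twiceSquare _) = refl

  h-index : ∀ s → h (index s) ≡ 1
  h-index s = begin
    h n                           ≡⟨ cong sum (map-upTo term n) ⟩
    sum (applyUpTo term n)        ≡⟨ sum-applyUpTo-single n term root-in-range off-root ⟩
    hTerm n (suc (pred (root s))) ≡⟨ cong (hTerm n) (suc-pred-root s) ⟩
    hTerm n (root s)              ≡⟨ hTerm-root s ⟩
    1                             ∎
    where
    open ≡-Reasoning
    n : ℕ
    n = index s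
    term : ℕ → ℕ
    term k = hTerm n (suc k)
    root-in-range : pred (root s) < n
    root-in-range = subst (_≤ n) (sym (suc-pred-root s)) (root≤index s)
    off-root : ∀ k → k ≢ pred (root s) → term k ≡ 0
    off-root k k≢root with term k ≟ 0
    ... | yes term≡0 = term≡0
    ... | no  term≢0 with hTerm≢0⇒root term≢0
    ...   | t , index-t≡n , root-t≡k rewrite index-injective t s index-t≡n =
      contradiction (cong pred (sym root-t≡k)) k≢root

  h≢0⇒index : ∀ n → h n ≢ 0 → ∃ λ s → index s ≡ n
  h≢0⇒index n h≢0 with sum-applyUpTo≢0 n (λ k → hTerm n (suc k)) (h≢0 ∘ trans (cong sum (map-upTo _ n)))
  ... | _ , term≢0 = let s , index-s≡n , _ = hTerm≢0⇒root term≢0 in s , index-s≡n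

open Arithmetic using (Shape; square; twiceSquare; index; index-injective; h-index; h≢0⇒index)

open import Data.Integer using (ℤ; +_; -[1+_]; -_; _+_; _-_; _*_; 0ℤ; 1ℤ; ∣_∣; _⊖_)
import Data.Integer.Properties as ℤ
open import Data.Integer.DivMod using (_/ℕ_; _%ℕ_; n%ℕd<d; a≡a%ℕn+[a/ℕn]*n)
open import Data.Integer.Tactic.RingSolver using (solve-∀)

least-witness : ∀ {P : ℕ → Set} → (∀ n → Dec (P n)) → ∀ {n} → P n →
                ∃ λ m → P m × (∀ {k} → k ℕ.< m → ¬ P k)
least-witness {P} P? {n} Pn
  with Fin.¬∀⟶∃¬-smallest (suc n) (¬_ ∘ P ∘ toℕ) (¬? ∘ P? ∘ toℕ)
         (λ all-fail → all-fail (Fin.fromℕ n) (subst P (sym (Fin.toℕ-fromℕ n)) Pn))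
... | i , ¬¬Pi , below =
  toℕ i , decidable-stable (P? _) ¬¬Pi ,
  λ k<i Pk → below (fromℕ< k<i) (subst P (sym (trans (Fin.toℕ-inject (fromℕ< k<i)) (Fin.toℕ-fromℕ< k<i))) Pk)

+-self-injective : ∀ {x y} → x ℕ.+ x ≡ y ℕ.+ y → x ≡ y
+-self-injective {x} {y} eq = trans (ℕ.n≡⌊n+n/2⌋ x) (trans (cong ℕ.⌊_/2⌋ eq) (sym (ℕ.n≡⌊n+n/2⌋ y)))

m≡n+o⇒m-n≡o : ∀ {m n o} → m ≡ n + o → m - n ≡ o
m≡n+o⇒m-n≡o {n = n} {o} refl = cancel n o
  where
  cancel : ∀ n o → n + o - n ≡ o
  cancel = solve-∀

congruent-residues : ∀ {p q a x} → p ℕ.< a → q ℕ.< a → + p - + q ≡ x * + a → x ≡ 0ℤ × p ≡ q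
congruent-residues {p} {q} {a} {x} p<a q<a p-q≡xa =
  x≡0 , ℤ.+-injective (ℤ.i-j≡0⇒i≡j (+ p) (+ q) (trans p-q≡xa (cong (_* + a) x≡0)))
  where
  open ℕ.≤-Reasoning
  ∣x∣a<a : ∣ x ∣ ℕ.* a ℕ.< a
  ∣x∣a<a = begin-strict
    ∣ x ∣ ℕ.* a   ≡⟨ ℤ.abs-* x (+ a) ⟨
    ∣ x * + a ∣   ≡⟨ cong ∣_∣ p-q≡xa ⟨
    ∣ + p - + q ∣ ≡⟨ cong ∣_∣ (ℤ.m-n≡m⊖n p q) ⟩
    ∣ p ⊖ q ∣     ≤⟨ ℤ.∣m⊝n∣≤m⊔n p q ⟩
    p ℕ.⊔ q       <⟨ ℕ.⊔-lub p<a q<a ⟩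
    a             ∎
  x≡0 : x ≡ 0ℤ
  x≡0 = ℤ.∣i∣≡0⇒i≡0 (ℕ.n<1⇒n≡0
    (ℕ.*-cancelʳ-< a ∣ x ∣ 1 (subst (∣ x ∣ ℕ.* a ℕ.<_) (sym (ℕ.*-identityˡ a)) ∣x∣a<a)))

infix 25 _·_

_·_ : ℤ → Λ → Λ
z · (a , b) = (z * a , z * b)

-ᵥ-anticomm : ∀ u w → -ᵥ (u -ᵥ w) ≡ w -ᵥ u
-ᵥ-anticomm (a , b) (c , d) = cong₂ _,_ (anticomm a c) (anticomm b d)
  where
  anticomm : ∀ a c → - (a - c) ≡ c - a
  anticomm = solve-∀

-ᵥ-telescope : ∀ u v w → (u -ᵥ v) +ᵥ (v -ᵥ w) ≡ u -ᵥ w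
-ᵥ-telescope (a , b) (c , d) (e , f) = cong₂ _,_ (telescope a c e) (telescope b d f)
  where
  telescope : ∀ a c e → (a - c) + (c - e) ≡ a - e
  telescope = solve-∀

-ᵥ-identityʳ : ∀ v → v -ᵥ 0ᵥ ≡ v
-ᵥ-identityʳ (a , b) = cong₂ _,_ (ℤ.+-identityʳ a) (ℤ.+-identityʳ b)

axis-difference : ∀ {x y} → y ℕ.≤ x → (+ x , 0ℤ) -ᵥ (+ y , 0ℤ) ≡ (+ (x ℕ.∸ y) , 0ℤ)
axis-difference {x} {y} y≤x = cong (_, 0ℤ) (trans (ℤ.m-n≡m⊖n x y) (ℤ.⊖-≥ y≤x))

Span : Λ → Λ → Subset
Span u w v = ∃₂ λ x y → v ≡ x · u +ᵥ y · w

module Subgroup {K : Subset} (K-sub : IsSubgroup K) where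
  open IsSubgroup K-sub

  infix 4 _∼_

  record _∼_ (u w : Λ) : Set where
    constructor congruent
    field difference∈K : K (u -ᵥ w)
  open _∼_ public

  ∼-sym : ∀ {u w} → u ∼ w → w ∼ u
  ∼-sym {u} {w} (congruent u-w∈K) = congruent (subst K (-ᵥ-anticomm u w) (closed-- u-w∈K))

  ∼-trans : ∀ {u v w} → u ∼ v → v ∼ w → u ∼ w
  ∼-trans {u} {v} {w} (congruent u-v∈K) (congruent v-w∈K) =
    congruent (subst K (-ᵥ-telescope u v w) (closed-+ u-v∈K v-w∈K))

  ∈⇒∼0 : ∀ {v} → K v → v ∼ 0ᵥ
  ∈⇒∼0 {v} v∈K = congruent (subst K (sym (-ᵥ-identityʳ v)) v∈K)

  ∼0⇒∈ : ∀ {v} → v ∼ 0ᵥ → K v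
  ∼0⇒∈ {v} (congruent v-0∈K) = subst K (-ᵥ-identityʳ v) v-0∈K

  ∈-resp-∼ : ∀ {u w} → u ∼ w → K w → K u
  ∈-resp-∼ u∼w w∈K = ∼0⇒∈ (∼-trans u∼w (∈⇒∼0 w∈K))

  closed-ℕ· : ∀ c {v} → K v → K ((+ c) · v)
  closed-ℕ· zero    _           = has-zero
  closed-ℕ· (suc c) {a , b} v∈K =
    subst K (cong₂ _,_ (unfold a (+ c)) (unfold b (+ c))) (closed-+ v∈K (closed-ℕ· c v∈K))
    where
    unfold : ∀ a c → a + c * a ≡ (1ℤ + c) * a
    unfold = solve-∀

  closed-· : ∀ z {v} → K v → K (z · v)
  closed-· (+ c)    v∈K = closed-ℕ· c v∈K
  closed-· -[1+ c ] {a , b} v∈K =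
    subst K (cong₂ _,_ (ℤ.neg-distribˡ-* (+ suc c) a) (ℤ.neg-distribˡ-* (+ suc c) b))
      (closed-- (closed-ℕ· (suc c) v∈K))

  Span⊆ : ∀ {u w v} → K u → K w → Span u w v → K v
  Span⊆ u∈K w∈K (x , y , refl) = closed-+ (closed-· x u∈K) (closed-· y w∈K)

  index-≤ : ∀ {n n′} → HasIndex K n → HasIndex K n′ → n ℕ.≤ n′
  index-≤ (r , covers , separates) (r′ , covers′ , _) = Fin.injective⇒≤ class-injective
    where
    class : Fin _ → Fin _
    class i = proj₁ (covers′ (r i))
    r∼class : ∀ i → r i ∼ r′ (class i)
    r∼class i = congruent (proj₂ (covers′ (r i)))
    class-injective : ∀ {i j} → class i ≡ class j → i ≡ j
    class-injective {i} {j} same = separates i j (difference∈K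
      (∼-trans (r∼class i) (∼-sym (subst (λ c → r j ∼ r′ c) (sym same) (r∼class j)))))

  index-unique : ∀ {n n′} → HasIndex K n → HasIndex K n′ → n ≡ n′
  index-unique idx idx′ = ℕ.≤-antisym (index-≤ idx idx′) (index-≤ idx′ idx)

  ∈? : ∀ {n} → HasIndex K n → ∀ v → Dec (K v)
  ∈? (r , covers , separates) v with covers v | covers 0ᵥ
  ... | i , v-rᵢ∈K | j , 0-rⱼ∈K with i Fin.≟ j
  ...   | yes refl = yes (∼0⇒∈ (∼-trans (congruent v-rᵢ∈K) (∼-sym (congruent 0-rⱼ∈K))))
  ...   | no  i≢j  = no λ v∈K → i≢j (separates i j (difference∈K
    (∼-trans (∼-sym (congruent v-rᵢ∈K)) (∼-trans (∈⇒∼0 v∈K) (congruent 0-rⱼ∈K)))))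

≐-sym : ∀ {K L} → K ≐ L → L ≐ K
≐-sym K≐L v = ⇔.sym (K≐L v)

HasIndex-resp-≐ : ∀ {K L n} → K ≐ L → HasIndex K n → HasIndex L n
HasIndex-resp-≐ K≐L (r , covers , separates) =
  r , (λ v → let i , v-rᵢ∈K = covers v in i , to (K≐L _) v-rᵢ∈K) ,
  (λ i j rᵢ-rⱼ∈L → separates i j (from (K≐L _) rᵢ-rⱼ∈L))

Stable : (Λ → Λ) → Subset → Set
Stable f K = ∀ {v} → K v → K (f v)

Preserves⇒Stable : ∀ {f K} → Preserves f K → Stable f K
Preserves⇒Stable f[K]≐K {v} v∈K = to (f[K]≐K _) (v , v∈K , refl)

Stable⇒Preserves : ∀ {f K} (g : Λ → Λ) → (∀ v → f (g v) ≡ v) →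
                   Stable f K → Stable g K → Preserves f K
Stable⇒Preserves g f∘g≗id f-stable g-stable w =
  mk⇔ (λ { (v , v∈K , refl) → f-stable v∈K }) (λ w∈K → g w , g-stable w∈K , f∘g≗id w)

Stable⇒Preserves-ψ : ∀ {K} → Stable ψ K → Preserves ψ K
Stable⇒Preserves-ψ ψ-stable =
  Stable⇒Preserves (ψ ∘ ψ ∘ ψ) ψ⁴≗id ψ-stable (ψ-stable ∘ ψ-stable ∘ ψ-stable)
  where
  ψ⁴≗id : ∀ v → ψ (ψ (ψ (ψ v))) ≡ v
  ψ⁴≗id (a , b) = cong₂ _,_ (ℤ.neg-involutive a) (ℤ.neg-involutive b)

Stable⇒Preserves-T : ∀ {K} → Stable T K → Preserves T K
Stable⇒Preserves-T T-stable = Stable⇒Preserves T T²≗id T-stable T-stable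
  where
  T²≗id : ∀ v → T (T v) ≡ v
  T²≗id (a , b) = cong (_, b) (ℤ.neg-involutive a)

Span-isSubgroup : ∀ u w → IsSubgroup (Span u w)
Span-isSubgroup (a , b) (c , d) = record
  { has-zero = 0ℤ , 0ℤ , refl
  ; closed-+ = λ { (x , y , refl) (x′ , y′ , refl) →
      x + x′ , y + y′ , cong₂ _,_ (add x y x′ y′ a c) (add x y x′ y′ b d) }
  ; closed-- = λ { (x , y , refl) → - x , - y , cong₂ _,_ (neg x y a c) (neg x y b d) }
  }
  where
  add : ∀ x y x′ y′ a c → (x * a + y * c) + (x′ * a + y′ * c) ≡ (x + x′) * a + (y + y′) * c
  add = solve-∀
  neg : ∀ x y a c → - (x * a + y * c) ≡ - x * a + - y * c
  neg = solve-∀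

left∈Span : ∀ u w → Span u w u
left∈Span (a , b) (c , d) = 1ℤ , 0ℤ , cong₂ _,_ (unit a c) (unit b d)
  where
  unit : ∀ a c → a ≡ 1ℤ * a + 0ℤ * c
  unit = solve-∀

right∈Span : ∀ u w → Span u w w
right∈Span (a , b) (c , d) = 0ℤ , 1ℤ , cong₂ _,_ (unit a c) (unit b d)
  where
  unit : ∀ a c → c ≡ 0ℤ * a + 1ℤ * c
  unit = solve-∀

Linear : (Λ → Λ) → Set
Linear f = ∀ x y u w → f (x · u +ᵥ y · w) ≡ x · f u +ᵥ y · f w

negate-combination : ∀ x y a c → - (x * a + y * c) ≡ x * - a + y * - c
negate-combination = solve-∀

ψ-linear : Linear ψ
ψ-linear x y (a , b) (c , d) = cong (_, x * a + y * c) (negate-combination x y b d)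

T-linear : Linear T
T-linear x y (a , b) (c , d) = cong (_, x * b + y * d) (negate-combination x y a c)

Span-stable : ∀ {f u w} → Linear f → Span u w (f u) → Span u w (f w) → Stable f (Span u w)
Span-stable {f} {u} {w} f-linear fu∈S fw∈S (x , y , refl) =
  subst (Span u w) (sym (f-linear x y u w)) (Span⊆ fu∈S fw∈S (x , y , refl))
  where open Subgroup (Span-isSubgroup u w)

module Triangular (a b : ℕ) .{{_ : ℕ.NonZero a}} .{{_ : ℕ.NonZero b}} (c : ℤ) where

  Triangular : Subset
  Triangular = Span (+ a , c) (0ℤ , + b)

  grid : Fin a × Fin b → Λ
  grid (i , j) = (+ toℕ i , + toℕ j)

  reduce : ∀ v → ∃ λ ij → Triangular (v -ᵥ grid ij)
  reduce (p , q) = (fromℕ< (n%ℕd<d p a) , fromℕ< (n%ℕd<d q′ b)) , x , y ,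
    cong₂ _,_ (trans (cong (λ r → p - + r) (Fin.toℕ-fromℕ< (n%ℕd<d p a))) first)
              (trans (cong (λ r → q - + r) (Fin.toℕ-fromℕ< (n%ℕd<d q′ b))) second)
    where
    open ≡-Reasoning
    x q′ y : ℤ
    x = p /ℕ a
    q′ = q - x * c
    y = q′ /ℕ b
    drop-zero : ∀ z y → z ≡ z + y * 0ℤ
    drop-zero = solve-∀
    regroup : ∀ q r s → q - r ≡ (q - s - r) + s
    regroup = solve-∀
    first : p - + (p %ℕ a) ≡ x * + a + y * 0ℤ
    first = trans (m≡n+o⇒m-n≡o (a≡a%ℕn+[a/ℕn]*n p a)) (drop-zero (x * + a) y)
    second : q - + (q′ %ℕ b) ≡ x * c + y * + b
    second = begin
      q - r₂            ≡⟨ regroup q r₂ (x * c) ⟩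
      q′ - r₂ + x * c   ≡⟨ cong (_+ x * c) (m≡n+o⇒m-n≡o {o = y * + b} (a≡a%ℕn+[a/ℕn]*n q′ b)) ⟩
      y * + b + x * c   ≡⟨ ℤ.+-comm (y * + b) (x * c) ⟩
      x * c + y * + b   ∎
      where
      r₂ : ℤ
      r₂ = + (q′ %ℕ b)

  grid-separated : ∀ ij ij′ → Triangular (grid ij -ᵥ grid ij′) → ij ≡ ij′
  grid-separated (i , j) (i′ , j′) (x , y , diff≡) =
    cong₂ _,_ (Fin.toℕ-injective (proj₂ first)) (Fin.toℕ-injective (proj₂ second))
    where
    drop-zero : ∀ z y → z + y * 0ℤ ≡ z
    drop-zero = solve-∀
    first : x ≡ 0ℤ × toℕ i ≡ toℕ i′
    first = congruent-residues (Fin.toℕ<n i) (Fin.toℕ<n i′) (trans (cong proj₁ diff≡) (drop-zero (x * + a) y))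
    second : y ≡ 0ℤ × toℕ j ≡ toℕ j′
    second = congruent-residues (Fin.toℕ<n j) (Fin.toℕ<n j′)
      (trans (cong proj₂ diff≡) (trans (cong (λ x → x * c + y * + b) (proj₁ first)) (ℤ.+-identityˡ (y * + b))))

  Triangular-index : HasIndex Triangular (a ℕ.* b)
  Triangular-index = grid ∘ split , covers , separates
    where
    split : Fin (a ℕ.* b) → Fin a × Fin b
    split = Fin.remQuot b
    covers : ∀ v → ∃ λ k → Triangular (v -ᵥ grid (split k))
    covers v = let ij , v-ij∈T = reduce v in
      uncurry Fin.combine ij , subst (λ ij → Triangular (v -ᵥ grid ij)) (sym (Fin.remQuot-combine _ _)) v-ij∈T
    separates : ∀ k l → Triangular (grid (split k) -ᵥ grid (split l)) → k ≡ l
    separates k l k-l∈T = begin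
      k                             ≡⟨ Fin.combine-remQuot {a} b k ⟨
      uncurry Fin.combine (split k) ≡⟨ cong (uncurry Fin.combine) (grid-separated _ _ k-l∈T) ⟩
      uncurry Fin.combine (split l) ≡⟨ Fin.combine-remQuot {a} b l ⟩
      l                             ∎
      where open ≡-Reasoning

lattice : Shape → Subset
lattice (square m)      = Span (+ suc m , 0ℤ) (0ℤ , + suc m)
lattice (twiceSquare k) = Span (+ suc k , + suc k) (0ℤ , + suc k + + suc k)

lattice-isSubgroup : ∀ s → IsSubgroup (lattice s)
lattice-isSubgroup (square _)      = Span-isSubgroup _ _
lattice-isSubgroup (twiceSquare _) = Span-isSubgroup _ _

lattice-index : ∀ s → HasIndex (lattice s) (index s)
lattice-index (square m)      = Triangular.Triangular-index (suc m) (suc m) 0ℤ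
lattice-index (twiceSquare k) =
  subst (HasIndex (lattice (twiceSquare k)))
    (cong (λ t → suc k ℕ.* (suc k ℕ.+ t)) (sym (ℕ.+-identityʳ (suc k))))
    (Triangular.Triangular-index (suc k) (suc k ℕ.+ suc k) (+ suc k))

module _ (κ : ℤ) where
  private
    u w : Λ
    u = (κ , κ)
    w = (0ℤ , κ + κ)

  antidiagonal∈Span : Span u w (- κ , κ)
  antidiagonal∈Span = - 1ℤ , 1ℤ , cong₂ _,_ (first κ) (second κ)
    where
    first : ∀ κ → - κ ≡ - 1ℤ * κ + 1ℤ * 0ℤ
    first = solve-∀
    second : ∀ κ → κ ≡ - 1ℤ * κ + 1ℤ * (κ + κ)
    second = solve-∀

  axis∈Span : Span u w (κ + κ , 0ℤ)
  axis∈Span = 1ℤ + 1ℤ , - 1ℤ , cong₂ _,_ (first κ) (second κ)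
    where
    first : ∀ κ → κ + κ ≡ (1ℤ + 1ℤ) * κ + - 1ℤ * 0ℤ
    first = solve-∀
    second : ∀ κ → 0ℤ ≡ (1ℤ + 1ℤ) * κ + - 1ℤ * (κ + κ)
    second = solve-∀

lattice-ψ-stable : ∀ s → Stable ψ (lattice s)
lattice-ψ-stable s@(square m) =
  Span-stable ψ-linear (right∈Span _ _) (closed-- (left∈Span (+ suc m , 0ℤ) _))
  where open IsSubgroup (lattice-isSubgroup s)
lattice-ψ-stable s@(twiceSquare k) =
  Span-stable ψ-linear (antidiagonal∈Span (+ suc k)) (closed-- (axis∈Span _))
  where open IsSubgroup (lattice-isSubgroup s)

lattice-T-stable : ∀ s → Stable T (lattice s)
lattice-T-stable s@(square m) =
  Span-stable T-linear (closed-- (left∈Span (+ suc m , 0ℤ) _)) (right∈Span _ _)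
  where open IsSubgroup (lattice-isSubgroup s)
lattice-T-stable (twiceSquare k) =
  Span-stable T-linear (antidiagonal∈Span (+ suc k)) (right∈Span _ _)

Admissible : ℕ → Subset → Set
Admissible n K = IsSubgroup K × HasIndex K n × Preserves ψ K × Preserves T K

lattice-admissible : ∀ s → Admissible (index s) (lattice s)
lattice-admissible s = lattice-isSubgroup s , lattice-index s ,
  Stable⇒Preserves-ψ (lattice-ψ-stable s) , Stable⇒Preserves-T (lattice-T-stable s)

Classified : ℕ → Subset → Set
Classified n K = ∃ λ s → index s ≡ n × K ≐ lattice s

module Classification {K : Subset} {n : ℕ} (K-admissible : Admissible n K) where
  private
    K-sub : IsSubgroup K
    K-sub = proj₁ K-admissible
    K-index : HasIndex K n
    K-index = proj₁ (proj₂ K-admissible)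
    ψ-stable : Stable ψ K
    ψ-stable = Preserves⇒Stable (proj₁ (proj₂ (proj₂ K-admissible)))
    T-stable : Stable T K
    T-stable = Preserves⇒Stable (proj₂ (proj₂ (proj₂ K-admissible)))
  open IsSubgroup K-sub
  open Subgroup K-sub

  classified : ∀ s → K ≐ lattice s → Classified n K
  classified s K≐lattice =
    s , sym (index-unique K-index (HasIndex-resp-≐ (≐-sym K≐lattice) (lattice-index s))) , K≐lattice

  coset : ∀ v → ∃ λ c → v ∼ proj₁ K-index c
  coset v = let c , v-c∈K = proj₁ (proj₂ K-index) v in c , congruent v-c∈K

  PositiveOnAxis : ℕ → Set
  PositiveOnAxis x = 0 ℕ.< x × K (+ x , 0ℤ)

  positive-on-axis? : ∀ x → Dec (PositiveOnAxis x)
  positive-on-axis? x = (0 ℕ.<? x) ×-dec ∈? K-index (+ x , 0ℤ)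

  positive-on-axis : ∃ PositiveOnAxis
  positive-on-axis with Fin.pigeonhole (ℕ.n<1+n n) (λ i → proj₁ (coset (+ toℕ i , 0ℤ)))
  ... | i , j , i<j , same = toℕ j ℕ.∸ toℕ i , ℕ.m<n⇒0<n∸m i<j ,
    subst K (axis-difference (ℕ.<⇒≤ i<j)) (difference∈K (∼-trans (proj₂ (coset _))
      (∼-sym (subst (λ c → _ ∼ proj₁ K-index c) same (proj₂ (coset (+ toℕ i , 0ℤ)))))))

  module Modulus (s : ℕ) (m∈K : K (+ suc s , 0ℤ))
                 (minimal : ∀ {x} → K (+ x , 0ℤ) → x ℕ.< suc s → x ≡ 0) where
    m : ℕ
    m = suc s

    L : Subset
    L = lattice (square s)

    L⊆K : ∀ {v} → L v → K v
    L⊆K = Span⊆ m∈K (ψ-stable m∈K)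

    axis-cases : ∀ {x} → K (+ x , 0ℤ) → x ℕ.< m ℕ.+ m → x ≡ 0 ⊎ x ≡ m
    axis-cases {x} x∈K x<2m with x ℕ.<? m
    ... | yes x<m = inj₁ (minimal x∈K x<m)
    ... | no  x≮m = inj₂ (ℕ.≤-antisym (ℕ.m∸n≡0⇒m≤n x∸m≡0) m≤x)
      where
      m≤x : m ℕ.≤ x
      m≤x = ℕ.≮⇒≥ x≮m
      x∸m≡0 : x ℕ.∸ m ≡ 0
      x∸m≡0 = minimal (subst K (axis-difference m≤x) (closed-+ x∈K (closed-- m∈K))) (ℕ.m<n+o⇒m∸n<o x m x<2m)

    no-half-on-axis : ∀ {x} → K (+ x , 0ℤ) → x ℕ.+ x ≢ m
    no-half-on-axis {zero}  _   ()
    no-half-on-axis {suc x} x∈K 2x≡m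
      with minimal x∈K (subst (suc x ℕ.<_) 2x≡m (ℕ.m<m+n (suc x) (ℕ.s≤s ℕ.z≤n)))
    ... | ()

    doubled : ∀ {a b} → K (a , b) → K (a + a , 0ℤ)
    doubled {a} {b} v∈K = subst K (cong₂ _,_ (double a) (ℤ.+-inverseʳ b)) (closed-+ v∈K (closed-- (T-stable v∈K)))
      where
      double : ∀ a → a - - a ≡ a + a
      double = solve-∀

    rotated : ∀ {a b} → K (a , b) → K (b , - a)
    rotated {a} {b} v∈K = subst K (cong (_, - a) (ℤ.neg-involutive b)) (ψ-stable (ψ-stable (ψ-stable v∈K)))

    grid-cases : ∀ {i j} → i ℕ.< m → j ℕ.< m → K (+ i , + j) → (i ≡ 0 ⊎ i ℕ.+ i ≡ m) × j ≡ i
    grid-cases {i} {j} i<m j<m ij∈K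
      with axis-cases (doubled ij∈K) (ℕ.+-mono-< i<m i<m) | axis-cases (doubled (rotated ij∈K)) (ℕ.+-mono-< j<m j<m)
    ... | inj₁ 2i≡0 | inj₁ 2j≡0 = inj₁ i≡0 , trans (ℕ.m+n≡0⇒m≡0 j 2j≡0) (sym i≡0)
      where
      i≡0 : i ≡ 0
      i≡0 = ℕ.m+n≡0⇒m≡0 i 2i≡0
    ... | inj₂ 2i≡m | inj₂ 2j≡m = inj₂ 2i≡m , +-self-injective (trans 2j≡m (sym 2i≡m))
    ... | inj₁ 2i≡0 | inj₂ 2j≡m =
      contradiction 2j≡m (no-half-on-axis (rotated (subst (λ i → K (+ i , + j)) (ℕ.m+n≡0⇒m≡0 i 2i≡0) ij∈K)))
    ... | inj₂ 2i≡m | inj₁ 2j≡0 =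
      contradiction 2i≡m (no-half-on-axis (subst (λ j → K (+ i , + j)) (ℕ.m+n≡0⇒m≡0 j 2j≡0) ij∈K))

    reduce-in-K : ∀ {v} → K v → ∃ λ i → L (v -ᵥ (+ i , + i)) × K (+ i , + i) × (i ≡ 0 ⊎ i ℕ.+ i ≡ m)
    reduce-in-K {v} v∈K with Triangular.reduce m m 0ℤ v
    ... | (i , j) , v-g∈L with ∈-resp-∼ (∼-sym (congruent (L⊆K v-g∈L))) v∈K
    ...   | g∈K with grid-cases (Fin.toℕ<n i) (Fin.toℕ<n j) g∈K
    ...     | i≡0⊎2i≡m , j≡i =
      toℕ i , subst (λ t → L (v -ᵥ (+ toℕ i , + t))) j≡i v-g∈L ,
      subst (λ t → K (+ toℕ i , + t)) j≡i g∈K , i≡0⊎2i≡m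

    HalfDiagonal : ℕ → Set
    HalfDiagonal k = k ℕ.+ k ≡ m × K (+ k , + k)

    half-diagonal? : ∀ k → Dec (HalfDiagonal k)
    half-diagonal? k = (k ℕ.+ k ℕ.≟ m) ×-dec ∈? K-index (+ k , + k)

    twice-case : ∀ {k} → HalfDiagonal k → Classified n K
    twice-case {zero}  (() , _)
    twice-case {suc k} (2k≡m , kk∈K) = classified (twiceSquare k) λ v → mk⇔ K⊆M M⊆K
      where
      κ : ℤ
      κ = + suc k
      M : Subset
      M = lattice (twiceSquare k)
      open IsSubgroup (lattice-isSubgroup (twiceSquare k)) renaming (has-zero to 0∈M)
      open Subgroup (lattice-isSubgroup (twiceSquare k))
        renaming (Span⊆ to Span⊆M; ∈-resp-∼ to ∈M-resp-∼; congruent to congruentᴹ)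
      κ+κ≡m : κ + κ ≡ + m
      κ+κ≡m = cong +_ 2k≡m
      M⊆K : ∀ {v} → M v → K v
      M⊆K = Span⊆ kk∈K (subst (λ t → K (0ℤ , t)) (sym κ+κ≡m) (ψ-stable m∈K))
      L⊆M : ∀ {v} → L v → M v
      L⊆M = Span⊆M (subst (λ t → M (t , 0ℤ)) κ+κ≡m (axis∈Span κ))
                   (subst (λ t → M (0ℤ , t)) κ+κ≡m (right∈Span _ _))
      diagonal∈M : ∀ {i} → i ≡ 0 ⊎ i ℕ.+ i ≡ m → M (+ i , + i)
      diagonal∈M (inj₁ refl) = 0∈M
      diagonal∈M (inj₂ 2i≡m) =
        subst (λ t → M (+ t , + t)) (+-self-injective (trans 2k≡m (sym 2i≡m))) (left∈Span _ _)
      K⊆M : ∀ {v} → K v → M v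
      K⊆M v∈K = let _ , v-g∈L , _ , g-cases = reduce-in-K v∈K in
        ∈M-resp-∼ (congruentᴹ (L⊆M v-g∈L)) (diagonal∈M g-cases)

    square-case : ¬ HalfDiagonal ℕ.⌊ m /2⌋ → Classified n K
    square-case no-half = classified (square s) λ v → mk⇔ K⊆L L⊆K
      where
      open IsSubgroup (lattice-isSubgroup (square s)) renaming (has-zero to 0∈L)
      open Subgroup (lattice-isSubgroup (square s)) renaming (∈-resp-∼ to ∈L-resp-∼; congruent to congruentᴸ)
      diagonal∈L : ∀ {i} → K (+ i , + i) → i ≡ 0 ⊎ i ℕ.+ i ≡ m → L (+ i , + i)
      diagonal∈L _ (inj₁ refl) = 0∈L
      diagonal∈L {i} ii∈K (inj₂ 2i≡m) =
        contradiction (subst HalfDiagonal i≡half (2i≡m , ii∈K)) no-half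
        where
        i≡half : i ≡ ℕ.⌊ m /2⌋
        i≡half = trans (ℕ.n≡⌊n+n/2⌋ i) (cong ℕ.⌊_/2⌋ 2i≡m)
      K⊆L : ∀ {v} → K v → L v
      K⊆L v∈K = let _ , v-g∈L , g∈K , g-cases = reduce-in-K v∈K in
        ∈L-resp-∼ (congruentᴸ v-g∈L) (diagonal∈L g∈K g-cases)

    classify : Classified n K
    classify = case half-diagonal? ℕ.⌊ m /2⌋ of λ where
      (yes half-diagonal) → twice-case half-diagonal
      (no  no-half)       → square-case no-half

  below-least : ∀ {m} → (∀ {k} → k ℕ.< m → ¬ PositiveOnAxis k) →
                ∀ {x} → K (+ x , 0ℤ) → x ℕ.< m → x ≡ 0
  below-least _     {zero}  _   _   = refl
  below-least least {suc x} x∈K x<m = contradiction (ℕ.s≤s ℕ.z≤n , x∈K) (least x<m)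

  classify : Classified n K
  classify = case least-witness positive-on-axis? (proj₂ positive-on-axis) of λ where
    (zero  , (() , _) , _)
    (suc s , (_ , m∈K) , least) → Modulus.classify s m∈K (below-least least)

HasCount-single : ∀ {P : Subset → Set} K → P K → (∀ L → P L → K ≐ L) → HasCount P 1
HasCount-single K PK unique =
  (λ _ → K) , (λ _ → PK) , (λ { Fin.zero Fin.zero _ → refl }) , λ L PL → Fin.zero , unique L PL

HasCount-none : ∀ {P : Subset → Set} → (∀ K → ¬ P K) → HasCount P 0
HasCount-none none = (λ ()) , (λ ()) , (λ ()) , λ K PK → contradiction PK (none K)

classified⇒h≡1 : ∀ {n K} → Classified n K → h n ≡ 1
classified⇒h≡1 (s , refl , _) = h-index s

classified⇒≐ : ∀ {s K} → Classified (index s) K → lattice s ≐ K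
classified⇒≐ {s} (t , index-t≡index-s , K≐lattice-t) =
  subst (λ t → lattice t ≐ _) (index-injective t s index-t≡index-s) (≐-sym K≐lattice-t)

admissible-count : ∀ {n} → (∃ λ s → index s ≡ n) → HasCount (Admissible n) (h n)
admissible-count (s , refl) = subst (HasCount (Admissible (index s))) (sym (h-index s))
  (HasCount-single (lattice s) (lattice-admissible s) λ K → classified⇒≐ {s} ∘ Classification.classify)

lemma9 : (n : ℕ) → n ≥ 1 →
    HasCount (λ K → IsSubgroup K × HasIndex K n × Preserves ψ K × Preserves T K) (h n)
lemma9 n _ = case h n ℕ.≟ 0 of λ where
  (yes h≡0) → subst (HasCount (Admissible n)) (sym h≡0) (HasCount-none λ K K-admissible →
    contradiction (trans (sym (classified⇒h≡1 (Classification.classify K-admissible))) h≡0) λ ())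
  (no  h≢0) → admissible-count (h≢0⇒index n h≢0)
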